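{- Let $(X_1,I_1,Y_1)$ and $(X_2,I_2,Y_2)$ be polarities and $p:X_2\to X_1$, $q:Y_2\to Y_1$ maps such that: (i) for all $x'\in X_2,y'\in Y_2$: $x'I_2y'$ implies $p(x')I_1q(y')$; (ii) for all $x\in X_1,y'\in Y_2$: if $xI_1q(y')$ then there is $x'\in X_2$ with $x\le p(x')$ and $x'I_2y'$; (iii) for all $x'\in X_2,y\in Y_1$: if $p(x')I_1y$ then there is $y'\in Y_2$ with $y\le q(y')$ and $x'I_2y'$. Then $p^{ -1}$ maps Galois stable subsets of $X_1$ to Galois stable subsets of $X_2$, and $p^{ -1}:\mathcal G(X_1)\to\mathcal G(X_2)$ is a complete lattice homomorphism (preserves arbitrary joins and meets).
   Context: A polarity is $(X,I,Y)$ with $X,Y$ nonempty, $I\subseteq X\times Y$; $x\perp y$ iff $(x,y)\notin I$; $U^\perp=\{y:x\perp y\ \forall x\in U\}$, ${}^\perp V=\{x:x\perp y\ \forall y\in V\}$. $A\subseteq X$ is (Galois) stable if $A={}^\perp(A^\perp)$; $\mathcal G(X)$ is the complete lattice of stable sets under inclusion (meets are intersections, the join of a family is ${}^\perp((\bigcup)^\perp)$ of its union). Preorders: $x\le z$ iff $\{x\}^\perp\subseteq\{z\}^\perp$ on $X$; $y\le v$ iff ${}^\perp\{y\}\subseteq{}^\perp\{v\}$ on $Y$. -}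

module Defs where

open import Data.Product using (∃; Σ; _,_)
open import Relation.Nullary using (¬_)
open import Relation.Unary using (Pred; _≐_)
open import Level using (0ℓ)

record Polarity : Set₁ where
  field
    X   : Set
    Y   : Set
    I   : X → Y → Set
    x₀  : X
    y₀  : Y

  _⊥_ : X → Y → Set
  x ⊥ y = ¬ I x y

  upper : Pred X 0ℓ → Pred Y 0ℓ
  upper U y = ∀ x → U x → x ⊥ y

  lower : Pred Y 0ℓ → Pred X 0ℓ
  lower V x = ∀ y → V y → x ⊥ y

  Stable : Pred X 0ℓ → Set
  Stable A = A ≐ lower (upper A)

  _≤X_ : X → X → Set
  x ≤X z = ∀ y → x ⊥ y → z ⊥ y

  _≤Y_ : Y → Y → Set
  y ≤Y v = ∀ x → x ⊥ y → x ⊥ v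

  ⋁ : {J : Set} → (J → Pred X 0ℓ) → Pred X 0ℓ
  ⋁ {J} A = lower (upper (λ x → ∃ λ (j : J) → A j x))

  ⋀ : {J : Set} → (J → Pred X 0ℓ) → Pred X 0ℓ
  ⋀ {J} A x = ∀ (j : J) → A j x

open Polarity public

preimage : {A B : Set} → (A → B) → Pred B 0ℓ → Pred A 0ℓ
preimage p S a = S (p a)

{-# OPTIONS --safe #-}
-- Both directions of p⁻¹ ∘ closure = closure ∘ p⁻¹ come from transporting
-- orthogonality along q. By (i) and (iii), if y ∈ U^⊥ lies below q y′ then
-- y′ ∈ (p⁻¹ U)^⊥; by (i) and (ii), q sends (p⁻¹ U)^⊥ into U^⊥ whenever U is
-- an upset of ≤X, which stable sets and unions of them are. Preimages commute
-- with unions and intersections on the nose, so p⁻¹ maps stable sets to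
-- stable sets and joins ⊥((⋃ Aⱼ)^⊥) to joins.
module Submission where

open import Defs
open import Data.Product using (∃; _×_; _,_; proj₂)
open import Relation.Binary.Definitions using (_Respects_)
open import Relation.Unary using (Pred; _⊆_; _≐_; ⋃)
open import Level using (0ℓ)

closure : (P : Polarity) → Pred (X P) 0ℓ → Pred (X P) 0ℓ
closure P U = lower P (upper P U)

module _ (P : Polarity) where

  closure-extensive : (U : Pred (X P) 0ℓ) → U ⊆ closure P U
  closure-extensive U {x} x∈U y y∈U⊥ = y∈U⊥ x x∈U

  stable⇒respects-≤X : {A : Pred (X P) 0ℓ} → Stable P A → A Respects _≤X_ P
  stable⇒respects-≤X A-stable a≤b a∈A =
    proj₂ A-stable (λ y y∈A⊥ → a≤b y (y∈A⊥ _ a∈A))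

⋃-respects : {A J : Set} {_∼_ : A → A → Set} (U : J → Pred A 0ℓ) →
  (∀ j → U j Respects _∼_) → ⋃ J U Respects _∼_
⋃-respects U U-respects x∼y (j , x∈Uj) = j , U-respects j x∼y x∈Uj

module _ (P₁ P₂ : Polarity) (p : X P₂ → X P₁) (q : Y P₂ → Y P₁) where

  I-Preserving : Set
  I-Preserving = ∀ x′ y′ → I P₂ x′ y′ → I P₁ (p x′) (q y′)

  X-Lifting : Set
  X-Lifting = ∀ x y′ → I P₁ x (q y′) → ∃ λ x′ → _≤X_ P₁ x (p x′) × I P₂ x′ y′

  Y-Lifting : Set
  Y-Lifting = ∀ x′ y → I P₁ (p x′) y → ∃ λ y′ → _≤Y_ P₁ y (q y′) × I P₂ x′ y′

  upper-preimage-above : I-Preserving → {U : Pred (X P₁) 0ℓ} {y : Y P₁} {y′ : Y P₂} →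
    upper P₁ U y → _≤Y_ P₁ y (q y′) → upper P₂ (preimage p U) y′
  upper-preimage-above preserves y∈U⊥ y≤qy′ x′ px′∈U x′Iy′ =
    y≤qy′ (p x′) (y∈U⊥ (p x′) px′∈U) (preserves x′ _ x′Iy′)

  q-maps-upper-preimage : X-Lifting → {U : Pred (X P₁) 0ℓ} → U Respects _≤X_ P₁ →
    {y′ : Y P₂} → upper P₂ (preimage p U) y′ → upper P₁ U (q y′)
  q-maps-upper-preimage lifts U-upset {y′} y′∈⊥ x x∈U xIqy′ =
    let (x′ , x≤px′ , x′Iy′) = lifts x y′ xIqy′
    in y′∈⊥ x′ (U-upset x≤px′ x∈U) x′Iy′

  closure-preimage⊆preimage-closure : I-Preserving → Y-Lifting →
    (U : Pred (X P₁) 0ℓ) → closure P₂ (preimage p U) ⊆ preimage p (closure P₁ U)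
  closure-preimage⊆preimage-closure preserves lifts U {x′} x′∈cl y y∈U⊥ px′Iy =
    let (y′ , y≤qy′ , x′Iy′) = lifts x′ y px′Iy
    in x′∈cl y′ (upper-preimage-above preserves y∈U⊥ y≤qy′) x′Iy′

  preimage-closure⊆closure-preimage : I-Preserving → X-Lifting →
    {U : Pred (X P₁) 0ℓ} → U Respects _≤X_ P₁ →
    preimage p (closure P₁ U) ⊆ closure P₂ (preimage p U)
  preimage-closure⊆closure-preimage preserves lifts U-upset {x′} px′∈cl y′ y′∈⊥ x′Iy′ =
    px′∈cl (q y′) (q-maps-upper-preimage lifts U-upset y′∈⊥) (preserves x′ y′ x′Iy′)

corollary3p21 : (P₁ P₂ : Polarity) (p : X P₂ → X P₁) (q : Y P₂ → Y P₁) →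
    (∀ x′ y′ → I P₂ x′ y′ → I P₁ (p x′) (q y′)) →
    (∀ x y′ → I P₁ x (q y′) → ∃ λ x′ → _≤X_ P₁ x (p x′) × I P₂ x′ y′) →
    (∀ x′ y → I P₁ (p x′) y → ∃ λ y′ → _≤Y_ P₁ y (q y′) × I P₂ x′ y′) →
    ((A : Pred (X P₁) 0ℓ) → Stable P₁ A → Stable P₂ (preimage p A))
    × ((J : Set) (A : J → Pred (X P₁) 0ℓ) → (∀ j → Stable P₁ (A j)) →
        preimage p (⋁ P₁ A) ≐ ⋁ P₂ (λ j → preimage p (A j)))
    × ((J : Set) (A : J → Pred (X P₁) 0ℓ) → (∀ j → Stable P₁ (A j)) →
        preimage p (⋀ P₁ A) ≐ ⋀ P₂ (λ j → preimage p (A j)))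
corollary3p21 P₁ P₂ p q preserves x-lifts y-lifts = preimage-stable , preimage-⋁ , preimage-⋀
  where
  preimage-stable : (A : Pred (X P₁) 0ℓ) → Stable P₁ A → Stable P₂ (preimage p A)
  preimage-stable A A-stable =
    closure-extensive P₂ (preimage p A) ,
    λ x′∈cl → proj₂ A-stable
      (closure-preimage⊆preimage-closure P₁ P₂ p q preserves y-lifts A x′∈cl)

  preimage-⋁ : (J : Set) (A : J → Pred (X P₁) 0ℓ) → (∀ j → Stable P₁ (A j)) →
    preimage p (⋁ P₁ A) ≐ ⋁ P₂ (λ j → preimage p (A j))
  preimage-⋁ J A A-stable =
    preimage-closure⊆closure-preimage P₁ P₂ p q preserves x-lifts
      (⋃-respects A (λ j → stable⇒respects-≤X P₁ (A-stable j))) ,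
    closure-preimage⊆preimage-closure P₁ P₂ p q preserves y-lifts (⋃ J A)

  preimage-⋀ : (J : Set) (A : J → Pred (X P₁) 0ℓ) → (∀ j → Stable P₁ (A j)) →
    preimage p (⋀ P₁ A) ≐ ⋀ P₂ (λ j → preimage p (A j))
  preimage-⋀ J A _ = (λ x′∈⋀ → x′∈⋀) , (λ x′∈⋀ → x′∈⋀)
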